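{- There is a constant $c$ such that for every $n\ge 2$ the PCNF formula $\textsc{QUParity}_n$ has pathwidth at most $c$ (indeed the paper exhibits path decompositions of width $4$).
   Context: For literals/variables, $\mathrm{xor}_u(o_1,o_2,o,l_1,l_2) := (l_1\lor l_2\lor\neg o_1\lor o_2\lor o)\land(l_1\lor l_2\lor o_1\lor\neg o_2\lor o)\land(l_1\lor l_2\lor\neg o_1\lor\neg o_2\lor\neg o)\land(l_1\lor l_2\lor o_1\lor o_2\lor\neg o)$. $\textsc{QUParity}_n := \exists x_1\ldots\exists x_n\forall z_1\forall z_2\exists t_2\ldots\exists t_n.\ \mathrm{xor}_u(x_1,x_2,t_2,z_1,z_2)\land\mathrm{xor}_u(x_1,x_2,t_2,\neg z_1,\neg z_2)\land\bigwedge_{i=3}^n\big(\mathrm{xor}_u(t_{i-1},x_i,t_i,z_1,z_2)\land\mathrm{xor}_u(t_{i-1},x_i,t_i,\neg z_1,\neg z_2)\big)\land(z_1\lor z_2\lor t_n)\land(\neg z_1\lor\neg z_2\lor\neg t_n)$. The pathwidth of a PCNF formula is the pathwidth of its primal graph (vertices: variables; edges: pairs of variables occurring together in some clause). A path decomposition of a graph is a sequence of bags (vertex sets) such that every vertex and every edge is contained in some bag and the bags containing any given vertex are consecutive; its width is the maximum bag size minus one; pathwidth is the minimum width. -}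

module Defs where

open import Data.Nat using (ℕ; zero; suc; _+_; _∸_; _≤_)
open import Data.List using (List; []; _∷_; _++_; map; concat; upTo; length; lookup)
open import Data.List.Membership.Propositional using (_∈_)
open import Data.List.Relation.Unary.All using (All)
open import Data.List.Relation.Unary.Any using (Any)
open import Data.List.Relation.Unary.Unique.Propositional using (Unique)
open import Data.Fin as Fin using (Fin)
open import Data.Product using (_×_; ∃-syntax)
open import Relation.Binary.PropositionalEquality using (_≢_)

data Var : Set where
  x  : ℕ → Var
  z₁ : Var
  z₂ : Var
  t  : ℕ → Var

data Lit : Set where
  pos : Var → Lit
  neg : Var → Lit

¬ₗ : Lit → Lit
¬ₗ (pos v) = neg v
¬ₗ (neg v) = pos v

var : Lit → Var
var (pos v) = v
var (neg v) = v

Clause : Set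
Clause = List Lit

data Quant : Set where
  ∃q ∀q : Quant

record PCNF : Set where
  constructor mkPCNF
  field
    prefix : List (Quant × Var)
    matrix : List Clause

open import Data.Product using (_,_; proj₂)

xorᵤ : Lit → Lit → Lit → Lit → Lit → List Clause
xorᵤ o₁ o₂ o l₁ l₂ =
    (l₁ ∷ l₂ ∷ ¬ₗ o₁ ∷ o₂ ∷ o ∷ [])
  ∷ (l₁ ∷ l₂ ∷ o₁ ∷ ¬ₗ o₂ ∷ o ∷ [])
  ∷ (l₁ ∷ l₂ ∷ ¬ₗ o₁ ∷ ¬ₗ o₂ ∷ ¬ₗ o ∷ [])
  ∷ (l₁ ∷ l₂ ∷ o₁ ∷ o₂ ∷ ¬ₗ o ∷ [])
  ∷ []

-- QUParity_n
-- prefix: ∃x₁…∃xₙ ∀z₁ ∀z₂ ∃t₂…∃tₙ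

QUParity : ℕ → PCNF
QUParity n = mkPCNF pre mat
  where
  pre : List (Quant × Var)
  pre = map (λ k → ∃q , x (suc k)) (upTo n)
        ++ (∀q , z₁) ∷ (∀q , z₂) ∷ []
        ++ map (λ k → ∃q , t (2 + k)) (upTo (n ∸ 1))
  step : ℕ → List Clause
  step i = xorᵤ (pos (t (i ∸ 1))) (pos (x i)) (pos (t i)) (pos z₁) (pos z₂)
        ++ xorᵤ (pos (t (i ∸ 1))) (pos (x i)) (pos (t i)) (neg z₁) (neg z₂)
  mat : List Clause
  mat = xorᵤ (pos (x 1)) (pos (x 2)) (pos (t 2)) (pos z₁) (pos z₂)
        ++ xorᵤ (pos (x 1)) (pos (x 2)) (pos (t 2)) (neg z₁) (neg z₂)
        ++ concat (map (λ k → step (3 + k)) (upTo (n ∸ 2)))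
        ++ ((pos z₁ ∷ pos z₂ ∷ pos (t n) ∷ [])
           ∷ (neg z₁ ∷ neg z₂ ∷ neg (t n) ∷ []) ∷ [])

IsVertex : PCNF → Var → Set
IsVertex φ v = v ∈ map proj₂ (PCNF.prefix φ)
             ⊎' Any (λ C → Any (λ l → var l Relation.Binary.PropositionalEquality.≡ v) C) (PCNF.matrix φ)
  where open import Data.Sum using () renaming (_⊎_ to _⊎'_)

IsEdge : PCNF → Var → Var → Set
IsEdge φ u v = u ≢ v × Any (λ C → Any (λ l → var l Relation.Binary.PropositionalEquality.≡ u) C
                               × Any (λ l → var l Relation.Binary.PropositionalEquality.≡ v) C)
                          (PCNF.matrix φ)

record PathDecomposition (φ : PCNF) : Set where
  field
    bags        : List (List Var)
    bagsUnique  : All Unique bags      -- bags are sets (no repetitions)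
    coversVertices : ∀ v → IsVertex φ v → ∃[ i ] (v ∈ lookup bags i)
    coversEdges : ∀ u v → IsEdge φ u v → ∃[ i ] (u ∈ lookup bags i × v ∈ lookup bags i)
    consecutive : ∀ v (i j k : Fin (length bags)) → i Fin.≤ j → j Fin.≤ k →
                  v ∈ lookup bags i → v ∈ lookup bags k → v ∈ lookup bags j

HasWidthAtMost : ∀ {φ} → PathDecomposition φ → ℕ → Set
HasWidthAtMost D c = All (λ B → length B ≤ suc c) (PathDecomposition.bags D)

PathwidthAtMost : PCNF → ℕ → Set
PathwidthAtMost φ c = ∃[ D ] HasWidthAtMost {φ} D c

-- Every variable of QUParity_n meets a window of at most two consecutive bags
-- of the sequence
--   {z₁, z₂, x₁, x₂, t₂}, {z₁, z₂, t₂, x₃, t₃}, …, {z₁, z₂, t_{n-1}, x_n, t_n},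
-- apart from the universal variables z₁ and z₂, which lie in all of them; and each
-- clause of the i-th parity gadget only mentions z₁, z₂, t_{i-1}, x_i, t_i.
-- Hence this sequence is a path decomposition of width 4.
module Submission where

open import Defs
open import Data.Nat using (ℕ; _≤_)
open import Data.Product using (∃-syntax)

open import Data.Nat using (zero; suc; _+_; _<_; s≤s; z≤n)
open import Data.Nat.Properties using (≤-antisym; ≤-trans; ≤-refl; n≮n; m≤n⇒m<n∨m≡n)
open import Data.List using (List; []; _∷_; _++_; map; applyUpTo; length; lookup)
open import Data.List.Properties using (lookup-applyUpTo; length-applyUpTo)
open import Data.List.Membership.Propositional using (_∈_)
open import Data.List.Relation.Unary.All as All using (All; []; _∷_)
open import Data.List.Relation.Unary.All.Properties using (++⁺; concat⁺; map⁺; applyUpTo⁺₁; applyUpTo⁺₂)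
open import Data.List.Relation.Unary.Any using (Any; here; there)
open import Data.List.Relation.Unary.AllPairs using ([]; _∷_)
open import Data.List.Relation.Unary.Unique.Propositional using (Unique)
open import Data.Fin as Fin using (Fin; fromℕ<)
open import Data.Fin.Properties using (toℕ-fromℕ<)
open import Data.Product using (_×_; _,_; proj₂)
open import Data.Sum using (inj₁; inj₂)
open import Data.Empty using (⊥-elim)
open import Relation.Binary.PropositionalEquality using (_≡_; refl; sym; trans; cong; subst)

module _ (bag : ℕ → List Var) (n : ℕ) where

  InSomeBag : Var → Set
  InSomeBag v = ∃[ m ] (m < n × v ∈ bag m)

  ClauseInSomeBag : Clause → Set
  ClauseInSomeBag C = ∃[ m ] (m < n × All (λ l → var l ∈ bag m) C)

  private
    bags : List (List Var)
    bags = applyUpTo bag n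

    position : ∀ {m} → m < n → ∃[ i ] (lookup bags i ≡ bag m)
    position {m} m<n = i , trans (lookup-applyUpTo bag n i) (cong bag (toℕ-fromℕ< m<len))
      where
      m<len : m < length bags
      m<len = subst (m <_) (sym (length-applyUpTo bag n)) m<n
      i : Fin (length bags)
      i = fromℕ< m<len

    inSomeBag⇒inBag : ∀ {v} → InSomeBag v → ∃[ i ] (v ∈ lookup bags i)
    inSomeBag⇒inBag (m , m<n , v∈) with position m<n
    ... | i , eq = i , subst (_ ∈_) (sym eq) v∈

    occurs-in-bag : ∀ {B v C} → All (λ l → var l ∈ B) C → Any (λ l → var l ≡ v) C → v ∈ B
    occurs-in-bag {B} = All.lookupWith (λ l∈B eq → subst (_∈ B) eq l∈B)

  pathDecomposition : ∀ φ →
    (∀ m → Unique (bag m)) →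
    (∀ {v i j k} → i ≤ j → j ≤ k → v ∈ bag i → v ∈ bag k → v ∈ bag j) →
    All InSomeBag (map proj₂ (PCNF.prefix φ)) →
    All ClauseInSomeBag (PCNF.matrix φ) →
    PathDecomposition φ
  pathDecomposition φ unique convex prefix⊆ matrix⊆ = record
    { bags           = bags
    ; bagsUnique     = applyUpTo⁺₂ bag n unique
    ; coversVertices = coversVertices
    ; coversEdges    = coversEdges
    ; consecutive    = consecutive
    }
    where
    coversVertices : ∀ v → IsVertex φ v → ∃[ i ] (v ∈ lookup bags i)
    coversVertices v (inj₁ v∈prefix) = inSomeBag⇒inBag (All.lookup prefix⊆ v∈prefix)
    coversVertices v (inj₂ v∈matrix) with All.lookupAny matrix⊆ v∈matrix
    ... | (m , m<n , C⊆) , v∈C = inSomeBag⇒inBag (m , m<n , occurs-in-bag C⊆ v∈C)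

    coversEdges : ∀ u v → IsEdge φ u v → ∃[ i ] (u ∈ lookup bags i × v ∈ lookup bags i)
    coversEdges u v (_ , uv∈matrix) with All.lookupAny matrix⊆ uv∈matrix
    ... | (m , m<n , C⊆) , u∈C , v∈C with position m<n
    ...   | i , eq = i , subst (u ∈_) (sym eq) (occurs-in-bag C⊆ u∈C)
                       , subst (v ∈_) (sym eq) (occurs-in-bag C⊆ v∈C)

    consecutive : ∀ v (i j k : Fin (length bags)) → i Fin.≤ j → j Fin.≤ k →
                  v ∈ lookup bags i → v ∈ lookup bags k → v ∈ lookup bags j
    consecutive v i j k i≤j j≤k v∈i v∈k =
      subst (v ∈_) (sym (lookup-applyUpTo bag n j))
        (convex i≤j j≤k (subst (v ∈_) (lookup-applyUpTo bag n i) v∈i)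
                        (subst (v ∈_) (lookup-applyUpTo bag n k) v∈k))

quBag : ℕ → List Var
quBag zero    = z₁ ∷ z₂ ∷ x 1 ∷ x 2 ∷ t 2 ∷ []
quBag (suc m) = z₁ ∷ z₂ ∷ t (2 + m) ∷ x (3 + m) ∷ t (3 + m) ∷ []

data InQuBag : ℕ → Var → Set where
  z₁∈ : ∀ m → InQuBag m z₁
  z₂∈ : ∀ m → InQuBag m z₂
  x₁∈ : InQuBag 0 (x 1)
  x∈  : ∀ m → InQuBag m (x (2 + m))
  t∈  : ∀ m → InQuBag m (t (2 + m))
  t∈′ : ∀ m → InQuBag (suc m) (t (2 + m))

InQuBag⁺ : ∀ {m v} → InQuBag m v → v ∈ quBag m
InQuBag⁺ (z₁∈ zero)    = here refl
InQuBag⁺ (z₁∈ (suc m)) = here refl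
InQuBag⁺ (z₂∈ zero)    = there (here refl)
InQuBag⁺ (z₂∈ (suc m)) = there (here refl)
InQuBag⁺ x₁∈           = there (there (here refl))
InQuBag⁺ (x∈ zero)     = there (there (there (here refl)))
InQuBag⁺ (x∈ (suc m))  = there (there (there (here refl)))
InQuBag⁺ (t∈ zero)     = there (there (there (there (here refl))))
InQuBag⁺ (t∈ (suc m))  = there (there (there (there (here refl))))
InQuBag⁺ (t∈′ m)       = there (there (here refl))

InQuBag⁻ : ∀ {m v} → v ∈ quBag m → InQuBag m v
InQuBag⁻ {zero}  (here refl)                                 = z₁∈ 0
InQuBag⁻ {zero}  (there (here refl))                         = z₂∈ 0
InQuBag⁻ {zero}  (there (there (here refl)))                 = x₁∈
InQuBag⁻ {zero}  (there (there (there (here refl))))         = x∈ 0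
InQuBag⁻ {zero}  (there (there (there (there (here refl))))) = t∈ 0
InQuBag⁻ {suc m} (here refl)                                 = z₁∈ (suc m)
InQuBag⁻ {suc m} (there (here refl))                         = z₂∈ (suc m)
InQuBag⁻ {suc m} (there (there (here refl)))                 = t∈′ m
InQuBag⁻ {suc m} (there (there (there (here refl))))         = x∈ (suc m)
InQuBag⁻ {suc m} (there (there (there (there (here refl))))) = t∈ (suc m)

quBag-unique : ∀ m → Unique (quBag m)
quBag-unique zero =
  ((λ ()) ∷ (λ ()) ∷ (λ ()) ∷ (λ ()) ∷ []) ∷ ((λ ()) ∷ (λ ()) ∷ (λ ()) ∷ []) ∷
  ((λ ()) ∷ (λ ()) ∷ []) ∷ ((λ ()) ∷ []) ∷ [] ∷ []
quBag-unique (suc m) =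
  ((λ ()) ∷ (λ ()) ∷ (λ ()) ∷ (λ ()) ∷ []) ∷ ((λ ()) ∷ (λ ()) ∷ (λ ()) ∷ []) ∷
  ((λ ()) ∷ (λ ()) ∷ []) ∷ ((λ ()) ∷ []) ∷ [] ∷ []

quBag-length : ∀ m → length (quBag m) ≤ 5
quBag-length zero    = ≤-refl
quBag-length (suc m) = ≤-refl

squeeze : ∀ {v i j} → i ≤ j → j ≤ i → InQuBag i v → InQuBag j v
squeeze i≤j j≤i v∈i = subst (λ m → InQuBag m _) (≤-antisym i≤j j≤i) v∈i

InQuBag-convex : ∀ {v i j k} → i ≤ j → j ≤ k → InQuBag i v → InQuBag k v → InQuBag j v
InQuBag-convex _   _     (z₁∈ _) _        = z₁∈ _
InQuBag-convex _   _     (z₂∈ _) _        = z₂∈ _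
InQuBag-convex i≤j j≤i   x₁∈     x₁∈      = squeeze i≤j j≤i x₁∈
InQuBag-convex i≤j j≤i   (x∈ i)  (x∈ .i)  = squeeze i≤j j≤i (x∈ i)
InQuBag-convex i≤j j≤i   (t∈ i)  (t∈ .i)  = squeeze i≤j j≤i (t∈ i)
InQuBag-convex i≤j j≤i   (t∈′ i) (t∈′ .i) = squeeze i≤j j≤i (t∈′ i)
InQuBag-convex i≤j j≤i   (t∈′ i) (t∈ .i)  = ⊥-elim (n≮n i (≤-trans i≤j j≤i))
InQuBag-convex i≤j j≤1+i (t∈ i)  (t∈′ .i) with m≤n⇒m<n∨m≡n j≤1+i
... | inj₁ (s≤s j≤i) = squeeze i≤j j≤i (t∈ i)
... | inj₂ refl      = t∈′ i

quBag-convex : ∀ {v i j k} → i ≤ j → j ≤ k → v ∈ quBag i → v ∈ quBag k → v ∈ quBag j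
quBag-convex i≤j j≤k v∈i v∈k = InQuBag⁺ (InQuBag-convex i≤j j≤k (InQuBag⁻ v∈i) (InQuBag⁻ v∈k))

xorᵤ-vars : ∀ (P : Var → Set) o₁ o₂ o l₁ l₂ →
  P (var o₁) → P (var o₂) → P (var o) → P (var l₁) → P (var l₂) →
  All (All (λ l → P (var l))) (xorᵤ o₁ o₂ o l₁ l₂)
xorᵤ-vars P o₁ o₂ o l₁ l₂ p₁ p₂ p q₁ q₂ =
    (q₁ ∷ q₂ ∷ ¬ₗ-var o₁ p₁ ∷ p₂ ∷ p ∷ [])
  ∷ (q₁ ∷ q₂ ∷ p₁ ∷ ¬ₗ-var o₂ p₂ ∷ p ∷ [])
  ∷ (q₁ ∷ q₂ ∷ ¬ₗ-var o₁ p₁ ∷ ¬ₗ-var o₂ p₂ ∷ ¬ₗ-var o p ∷ [])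
  ∷ (q₁ ∷ q₂ ∷ p₁ ∷ p₂ ∷ ¬ₗ-var o p ∷ [])
  ∷ []
  where
  ¬ₗ-var : ∀ l → P (var l) → P (var (¬ₗ l))
  ¬ₗ-var (pos v) p = p
  ¬ₗ-var (neg v) p = p

quParity-prefix : ∀ K → All (InSomeBag quBag (suc K)) (map proj₂ (PCNF.prefix (QUParity (2 + K))))
quParity-prefix K =
  map⁺ (++⁺ (map⁺ (applyUpTo⁺₁ _ (2 + K) x-in-bag))
            ((0 , s≤s z≤n , InQuBag⁺ (z₁∈ 0)) ∷ (0 , s≤s z≤n , InQuBag⁺ (z₂∈ 0)) ∷
             map⁺ (applyUpTo⁺₁ _ (suc K) λ {m} m<n → m , m<n , InQuBag⁺ (t∈ m))))
  where
  x-in-bag : ∀ {k} → k < 2 + K → InSomeBag quBag (suc K) (x (suc k))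
  x-in-bag {zero}  _         = 0 , s≤s z≤n , InQuBag⁺ x₁∈
  x-in-bag {suc m} (s≤s m<n) = m , m<n , InQuBag⁺ (x∈ m)

quParity-matrix : ∀ K → All (ClauseInSomeBag quBag (suc K)) (PCNF.matrix (QUParity (2 + K)))
quParity-matrix K =
  ++⁺ (gadget (s≤s z≤n) x₁∈ (x∈ 0) (t∈ 0) (pos z₁) (pos z₂) (z₁∈ _) (z₂∈ _))
  (++⁺ (gadget (s≤s z≤n) x₁∈ (x∈ 0) (t∈ 0) (neg z₁) (neg z₂) (z₁∈ _) (z₂∈ _))
  (++⁺ (concat⁺ (map⁺ (applyUpTo⁺₁ _ K λ {m} m<K →
          ++⁺ (gadget (s≤s m<K) (t∈′ m) (x∈ (suc m)) (t∈ (suc m)) (pos z₁) (pos z₂) (z₁∈ _) (z₂∈ _))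
              (gadget (s≤s m<K) (t∈′ m) (x∈ (suc m)) (t∈ (suc m)) (neg z₁) (neg z₂) (z₁∈ _) (z₂∈ _)))))
       ((K , ≤-refl , z₁∈last ∷ z₂∈last ∷ InQuBag⁺ (t∈ K) ∷ []) ∷
        (K , ≤-refl , z₁∈last ∷ z₂∈last ∷ InQuBag⁺ (t∈ K) ∷ []) ∷ [])))
  where
  z₁∈last : z₁ ∈ quBag K
  z₁∈last = InQuBag⁺ (z₁∈ K)
  z₂∈last : z₂ ∈ quBag K
  z₂∈last = InQuBag⁺ (z₂∈ K)

  gadget : ∀ {m a b c} → m < suc K → InQuBag m a → InQuBag m b → InQuBag m c →
           ∀ l₁ l₂ → InQuBag m (var l₁) → InQuBag m (var l₂) →
           All (ClauseInSomeBag quBag (suc K)) (xorᵤ (pos a) (pos b) (pos c) l₁ l₂)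
  gadget {m} m<n a∈ b∈ c∈ l₁ l₂ l₁∈ l₂∈ =
    All.map (λ C⊆ → m , m<n , C⊆)
      (xorᵤ-vars (_∈ quBag m) _ _ _ l₁ l₂ (InQuBag⁺ a∈) (InQuBag⁺ b∈) (InQuBag⁺ c∈)
                 (InQuBag⁺ l₁∈) (InQuBag⁺ l₂∈))

lemma4 : ∃[ c ] (∀ (n : ℕ) → 2 ≤ n → PathwidthAtMost (QUParity n) c)
lemma4 = 4 , width4
  where
  width4 : ∀ n → 2 ≤ n → PathwidthAtMost (QUParity n) 4
  width4 (suc (suc K)) (s≤s (s≤s _)) =
    pathDecomposition quBag (suc K) (QUParity (2 + K))
      quBag-unique quBag-convex (quParity-prefix K) (quParity-matrix K)
    , applyUpTo⁺₂ quBag (suc K) quBag-length
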